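{- Let $\Delta\ge1$, $r\ge1$ be integers and let $\mathcal{T}^r_\Delta$ be the full $\Delta$-ary tree of radius $r$. Then $\alpha(\mathcal{T}^r_\Delta) \leq 2\,\omega(\mathcal{T}^r_\Delta)$.
   Context: The full $\Delta$-ary tree $\mathcal{T}^r_\Delta$ of radius $r$ is the rooted tree in which every non-leaf node has exactly $\Delta$ children and every leaf is at distance exactly $r$ from the root. A drawing of a rooted tree fixes a left-to-right order of the children of every node. The preorder traversal of a drawing lists the root, then recursively traverses the children's subtrees from left to right. Two nodes are incomparable if neither is a descendant of the other. A family $D$ of drawings of a rooted tree $\mathcal{T}$ is $3$-suitable if for every set $\{a_1,a_2,a_3\}$ of three pairwise incomparable vertices and every distinguished element, say $a_3$, some drawing in $D$ has a preorder traversal listing $a_3$ after both $a_1$ and $a_2$; it is weakly $3$-suitable if instead some drawing lists $a_3$ either after both or before both of $a_1,a_2$. $\alpha(\mathcal{T})$ and $\omega(\mathcal{T})$ denote the minimum sizes of a $3$-suitable and a weakly $3$-suitable family of drawings of $\mathcal{T}$, respectively. -}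

module Defs where

open import Data.Nat using (ℕ; zero; suc; _≤_; _*_)
open import Data.Fin using (Fin) renaming (_<_ to _<ᶠ_)
open import Data.Fin.Permutation using (Permutation′; _⟨$⟩ʳ_)
open import Data.List using (List; []; _∷_; [_]; _++_; length; lookup; concatMap; allFin)
open import Data.List.Membership.Propositional using (_∈_)
open import Data.Product using (Σ; ∃; ∃-syntax; _×_; _,_; proj₁)
open import Data.Sum using (_⊎_)
open import Relation.Binary.PropositionalEquality using (_≡_)
open import Relation.Nullary using (¬_)

-- Nodes of the full Δ-ary tree of radius r: root-to-node paths, i.e. lists of
-- child indices (Fin Δ) of length at most r.  The root is [].
Node : ℕ → ℕ → Set
Node Δ r = Σ (List (Fin Δ)) (λ p → length p ≤ r)

IsPrefix : ∀ {Δ} → List (Fin Δ) → List (Fin Δ) → Set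
IsPrefix p q = ∃[ s ] (p ++ s ≡ q)

Incomparable : ∀ {Δ r} → Node Δ r → Node Δ r → Set
Incomparable (p , _) (q , _) = ¬ IsPrefix p q × ¬ IsPrefix q p

-- A drawing fixes, at every node p, a left-to-right order of its Δ children:
-- the child in position k (from the left) is child number (d p ⟨$⟩ʳ k).
-- (Values at leaves are irrelevant.)
Drawing : ℕ → Set
Drawing Δ = List (Fin Δ) → Permutation′ Δ

preorderFrom : ∀ {Δ} → Drawing Δ → ℕ → List (Fin Δ) → List (List (Fin Δ))
preorderFrom d zero    p = [ p ]
preorderFrom {Δ} d (suc n) p =
  p ∷ concatMap (λ k → preorderFrom d n (p ++ [ d p ⟨$⟩ʳ k ])) (allFin Δ)

preorder : ∀ {Δ} → (r : ℕ) → Drawing Δ → List (List (Fin Δ))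
preorder r d = preorderFrom d r []

ListedBefore : ∀ {A : Set} → List A → A → A → Set
ListedBefore L u v =
  ∃[ i ] ∃[ j ] (i <ᶠ j × lookup L i ≡ u × lookup L j ≡ v)

Before : ∀ {Δ} r → Drawing Δ → Node Δ r → Node Δ r → Set
Before r d u v = ListedBefore (preorder r d) (proj₁ u) (proj₁ v)

PairwiseIncomparable : ∀ {Δ r} → Node Δ r → Node Δ r → Node Δ r → Set
PairwiseIncomparable a b c = Incomparable a b × Incomparable a c × Incomparable b c

-- Families of drawings are finite lists; the size of a family is its length.
-- 3-suitable: for every three pairwise incomparable nodes a₁ a₂ a₃ (a₃ the
-- distinguished one; all orderings are quantified) some drawing lists a₃
-- after both a₁ and a₂.
ThreeSuitable : ∀ Δ r → List (Drawing Δ) → Set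
ThreeSuitable Δ r D =
  (a₁ a₂ a₃ : Node Δ r) → PairwiseIncomparable a₁ a₂ a₃ →
  ∃[ d ] (d ∈ D × Before r d a₁ a₃ × Before r d a₂ a₃)

WeaklyThreeSuitable : ∀ Δ r → List (Drawing Δ) → Set
WeaklyThreeSuitable Δ r D =
  (a₁ a₂ a₃ : Node Δ r) → PairwiseIncomparable a₁ a₂ a₃ →
  ∃[ d ] (d ∈ D × ((Before r d a₁ a₃ × Before r d a₂ a₃)
                 ⊎ (Before r d a₃ a₁ × Before r d a₃ a₂)))

IsMinSize : ∀ {Δ} → (List (Drawing Δ) → Set) → ℕ → Set
IsMinSize P n =
  (∃[ D ] (P D × length D ≡ n)) × (∀ D → P D → n ≤ length D)

IsAlpha : ℕ → ℕ → ℕ → Set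
IsAlpha Δ r a = IsMinSize (ThreeSuitable Δ r) a

IsOmega : ℕ → ℕ → ℕ → Set
IsOmega Δ r w = IsMinSize (WeaklyThreeSuitable Δ r) w

module Submission where

-- Mirroring a drawing (reversing the order of the children at every node)
-- reverses the order in which any two incomparable nodes appear in the
-- preorder traversal: their lowest common ancestor lists the children on
-- their paths in the opposite order.  Hence if D is weakly 3-suitable, then
-- D together with the mirrors of its drawings is 3-suitable: a drawing that
-- lists a₃ before both a₁ and a₂ becomes, mirrored, one listing a₃ after both.

open import Defs
open import Data.Nat using (ℕ; zero; suc; _+_; _≤_; _<_; _*_; z≤n; s≤s)
open import Data.Nat.Properties using (∸-monoʳ-<; +-identityʳ)
open import Data.Fin using (Fin; toℕ; opposite) renaming (zero to fzero; suc to fsuc)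
open import Data.Fin.Properties using (opposite-prop; opposite-involutive; toℕ<n)
open import Data.Fin.Permutation using (_⟨$⟩ʳ_; _∘ₚ_; reverse)
open import Data.List using (List; []; _∷_; [_]; _++_; length; concatMap; allFin; tabulate; map)
open import Data.List.Properties using (++-assoc; ++-identityʳ; length-++; length-map)
open import Data.List.Membership.Propositional using (_∈_; find; lose)
open import Data.List.Membership.Propositional.Properties
  using (∈-++⁺ˡ; ∈-++⁺ʳ; ∈-++⁻; ∈-concatMap⁺; ∈-concatMap⁻; ∈-tabulate⁺; ∈-tabulate⁻; ∈-allFin; ∈-map⁺; ∈-lookup)
open import Data.List.Relation.Unary.Any using (here; there; index)
open import Data.List.Relation.Unary.Any.Properties using (lookup-index)
open import Data.Product using (∃-syntax; _×_; _,_; swap)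
open import Data.Sum using (_⊎_; inj₁; inj₂)
open import Data.Empty using (⊥-elim)
open import Relation.Binary.PropositionalEquality using (_≡_; refl; sym; trans; cong; subst; module ≡-Reasoning)
open import Relation.Nullary using (¬_)

data Precedes {A : Set} : List A → A → A → Set where
  first : ∀ {u v L} → v ∈ L → Precedes (u ∷ L) u v
  skip  : ∀ {x u v L} → Precedes L u v → Precedes (x ∷ L) u v

Precedes⇒ListedBefore : ∀ {A : Set} {L : List A} {u v} → Precedes L u v → ListedBefore L u v
Precedes⇒ListedBefore (first v∈) = fzero , fsuc (index v∈) , s≤s z≤n , refl , sym (lookup-index v∈)
Precedes⇒ListedBefore (skip p) with Precedes⇒ListedBefore p
... | i , j , i<j , u≡ , v≡ = fsuc i , fsuc j , s≤s i<j , u≡ , v≡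

ListedBefore⇒Precedes : ∀ {A : Set} (L : List A) {u v} → ListedBefore L u v → Precedes L u v
ListedBefore⇒Precedes (x ∷ L) (fzero , fsuc j , _ , refl , refl) = first (∈-lookup j)
ListedBefore⇒Precedes (x ∷ L) (fsuc i , fsuc j , s≤s i<j , u≡ , v≡) =
  skip (ListedBefore⇒Precedes L (i , j , i<j , u≡ , v≡))

Precedes-++⁺ˡ : ∀ {A : Set} {L : List A} M {u v} → Precedes L u v → Precedes (L ++ M) u v
Precedes-++⁺ˡ M (first v∈) = first (∈-++⁺ˡ v∈)
Precedes-++⁺ˡ M (skip p) = skip (Precedes-++⁺ˡ M p)

Precedes-++⁺ʳ : ∀ {A : Set} (L : List A) {M u v} → Precedes M u v → Precedes (L ++ M) u v
Precedes-++⁺ʳ []      p = p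
Precedes-++⁺ʳ (x ∷ L) p = skip (Precedes-++⁺ʳ L p)

Precedes-++⁺-across : ∀ {A : Set} {L : List A} M {u v} → u ∈ L → v ∈ M → Precedes (L ++ M) u v
Precedes-++⁺-across {L = x ∷ L} M (here refl) v∈ = first (∈-++⁺ʳ L v∈)
Precedes-++⁺-across M (there u∈) v∈ = skip (Precedes-++⁺-across M u∈ v∈)

Precedes-++⁻ : ∀ {A : Set} (L : List A) {M u v} → Precedes (L ++ M) u v →
  Precedes L u v ⊎ Precedes M u v ⊎ (u ∈ L × v ∈ M)
Precedes-++⁻ []      p = inj₂ (inj₁ p)
Precedes-++⁻ (x ∷ L) (first v∈) with ∈-++⁻ L v∈
... | inj₁ v∈L = inj₁ (first v∈L)
... | inj₂ v∈M = inj₂ (inj₂ (here refl , v∈M))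
Precedes-++⁻ (x ∷ L) (skip p) with Precedes-++⁻ L p
... | inj₁ q              = inj₁ (skip q)
... | inj₂ (inj₁ q)       = inj₂ (inj₁ q)
... | inj₂ (inj₂ (u∈ , v∈)) = inj₂ (inj₂ (there u∈ , v∈))

module _ {A B : Set} (f : A → List B) where

  Precedes-concatMap⁺ : ∀ {xs k u v} → k ∈ xs → Precedes (f k) u v → Precedes (concatMap f xs) u v
  Precedes-concatMap⁺ (here refl) p = Precedes-++⁺ˡ _ p
  Precedes-concatMap⁺ {x ∷ _} (there k∈) p = Precedes-++⁺ʳ (f x) (Precedes-concatMap⁺ k∈ p)

  Precedes-concatMap⁺-across : ∀ {xs k l u v} → Precedes xs k l → u ∈ f k → v ∈ f l →
    Precedes (concatMap f xs) u v
  Precedes-concatMap⁺-across (first l∈) u∈ v∈ = Precedes-++⁺-across _ u∈ (∈-concatMap⁺ f (lose l∈ v∈))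
  Precedes-concatMap⁺-across {x ∷ _} (skip p) u∈ v∈ =
    Precedes-++⁺ʳ (f x) (Precedes-concatMap⁺-across p u∈ v∈)

  Precedes-concatMap⁻ : ∀ xs {u v} → Precedes (concatMap f xs) u v →
    (∃[ k ] (k ∈ xs × Precedes (f k) u v))
    ⊎ (∃[ k ] ∃[ l ] (Precedes xs k l × u ∈ f k × v ∈ f l))
  Precedes-concatMap⁻ (x ∷ xs) p with Precedes-++⁻ (f x) p
  ... | inj₁ q = inj₁ (x , here refl , q)
  ... | inj₂ (inj₂ (u∈ , v∈)) with find (∈-concatMap⁻ f {xs = xs} v∈)
  ...   | l , l∈ , v∈l = inj₂ (x , l , first l∈ , u∈ , v∈l)
  Precedes-concatMap⁻ (x ∷ xs) p | inj₂ (inj₁ q) with Precedes-concatMap⁻ xs q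
  ... | inj₁ (k , k∈ , r) = inj₁ (k , there k∈ , r)
  ... | inj₂ (k , l , r , u∈ , v∈) = inj₂ (k , l , skip r , u∈ , v∈)

Precedes-tabulate⁺ : ∀ {X : Set} {n} (f : Fin n → X) {k l : Fin n} → toℕ k < toℕ l →
  Precedes (tabulate f) (f k) (f l)
Precedes-tabulate⁺ f {fzero}  {fsuc l} _         = first (∈-tabulate⁺ l)
Precedes-tabulate⁺ f {fsuc k} {fsuc l} (s≤s k<l) = skip (Precedes-tabulate⁺ (λ i → f (fsuc i)) k<l)

Precedes-allFin⁺ : ∀ {n} {k l : Fin n} → toℕ k < toℕ l → Precedes (allFin n) k l
Precedes-allFin⁺ = Precedes-tabulate⁺ (λ i → i)

Precedes-tabulate⁻ : ∀ {X : Set} {n} (f : Fin n → X) {x y} → Precedes (tabulate f) x y →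
  ∃[ k ] ∃[ l ] (toℕ k < toℕ l × x ≡ f k × y ≡ f l)
Precedes-tabulate⁻ {n = suc n} f (first y∈) with ∈-tabulate⁻ y∈
... | l , y≡ = fzero , fsuc l , s≤s z≤n , refl , y≡
Precedes-tabulate⁻ {n = suc n} f (skip p) with Precedes-tabulate⁻ (λ i → f (fsuc i)) p
... | k , l , k<l , x≡ , y≡ = fsuc k , fsuc l , s≤s k<l , x≡ , y≡

Precedes-allFin⁻ : ∀ {n} {k l : Fin n} → Precedes (allFin n) k l → toℕ k < toℕ l
Precedes-allFin⁻ p with Precedes-tabulate⁻ (λ i → i) p
... | _ , _ , k<l , refl , refl = k<l

opposite-reverses-< : ∀ {n} {k l : Fin n} → toℕ k < toℕ l → toℕ (opposite l) < toℕ (opposite k)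
opposite-reverses-< {suc n} {k} {l} k<l rewrite opposite-prop k | opposite-prop l =
  ∸-monoʳ-< (s≤s k<l) (toℕ<n l)

mirror : ∀ {Δ} → Drawing Δ → Drawing Δ
mirror d p = reverse ∘ₚ d p

childPreorder : ∀ {Δ} → Drawing Δ → ℕ → List (Fin Δ) → Fin Δ → List (List (Fin Δ))
childPreorder d n p k = preorderFrom d n (p ++ [ d p ⟨$⟩ʳ k ])

preorderFrom-prefix : ∀ {Δ} (d : Drawing Δ) n p {u} → u ∈ preorderFrom d n p → IsPrefix p u
preorderFrom-prefix d zero    p (here refl) = [] , ++-identityʳ p
preorderFrom-prefix d (suc n) p (here refl) = [] , ++-identityʳ p
preorderFrom-prefix {Δ} d (suc n) p (there u∈)
  with find (∈-concatMap⁻ (childPreorder d n p) {xs = allFin Δ} u∈)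
... | k , _ , u∈k with preorderFrom-prefix d n _ u∈k
...   | s , p++ks≡u = (d p ⟨$⟩ʳ k) ∷ s , trans (sym (++-assoc p [ d p ⟨$⟩ʳ k ] s)) p++ks≡u

module _ {Δ} (d : Drawing Δ) where

  private
    mirror-childPreorder : ∀ n p k →
      preorderFrom (mirror d) n (p ++ [ d p ⟨$⟩ʳ k ]) ≡ childPreorder (mirror d) n p (opposite k)
    mirror-childPreorder n p k =
      cong (λ i → preorderFrom (mirror d) n (p ++ [ d p ⟨$⟩ʳ i ])) (sym (opposite-involutive k))

  preorderFrom-mirror-⊆ : ∀ n p {u} → u ∈ preorderFrom d n p → u ∈ preorderFrom (mirror d) n p
  preorderFrom-mirror-⊆ zero    p u∈        = u∈
  preorderFrom-mirror-⊆ (suc n) p (here eq) = here eq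
  preorderFrom-mirror-⊆ (suc n) p (there u∈)
    with find (∈-concatMap⁻ (childPreorder d n p) {xs = allFin Δ} u∈)
  ... | k , _ , u∈k = there (∈-concatMap⁺ (childPreorder (mirror d) n p)
          (lose (∈-allFin (opposite k))
                (subst (_ ∈_) (mirror-childPreorder n p k) (preorderFrom-mirror-⊆ n _ u∈k))))

  -- A node is never listed before one of its descendants, so at the root of
  -- the traversal only the case of two different child subtrees remains,
  -- whose order the mirror reverses.
  mirror-reverses : ∀ n p {u v} → ¬ IsPrefix u v →
    Precedes (preorderFrom d n p) u v → Precedes (preorderFrom (mirror d) n p) v u
  mirror-reverses zero    p u⋠v (first ())
  mirror-reverses zero    p u⋠v (skip ())
  mirror-reverses (suc n) p u⋠v (first v∈) = ⊥-elim (u⋠v (preorderFrom-prefix d (suc n) p (there v∈)))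
  mirror-reverses (suc n) p u⋠v (skip u≺v) with Precedes-concatMap⁻ (childPreorder d n p) (allFin Δ) u≺v
  ... | inj₁ (k , _ , u≺v′) =
    skip (Precedes-concatMap⁺ (childPreorder (mirror d) n p) (∈-allFin (opposite k))
      (subst (λ L → Precedes L _ _) (mirror-childPreorder n p k) (mirror-reverses n _ u⋠v u≺v′)))
  ... | inj₂ (k , l , k≺l , u∈k , v∈l) =
    skip (Precedes-concatMap⁺-across (childPreorder (mirror d) n p)
      (Precedes-allFin⁺ (opposite-reverses-< (Precedes-allFin⁻ k≺l)))
      (subst (_ ∈_) (mirror-childPreorder n p l) (preorderFrom-mirror-⊆ n _ v∈l))
      (subst (_ ∈_) (mirror-childPreorder n p k) (preorderFrom-mirror-⊆ n _ u∈k)))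

Before-mirror : ∀ {Δ} r (d : Drawing Δ) {u v : Node Δ r} → Incomparable u v →
  Before r d u v → Before r (mirror d) v u
Before-mirror r d (u⋠v , _) u≺v =
  Precedes⇒ListedBefore (mirror-reverses d r [] u⋠v (ListedBefore⇒Precedes _ u≺v))

ThreeSuitable-++-mirror : ∀ {Δ r} {D : List (Drawing Δ)} →
  WeaklyThreeSuitable Δ r D → ThreeSuitable Δ r (D ++ map mirror D)
ThreeSuitable-++-mirror {r = r} {D} weak a₁ a₂ a₃ incomp@(_ , a₁∥a₃ , a₂∥a₃)
  with weak a₁ a₂ a₃ incomp
... | d , d∈ , inj₁ (a₁≺a₃ , a₂≺a₃) = d , ∈-++⁺ˡ d∈ , a₁≺a₃ , a₂≺a₃
... | d , d∈ , inj₂ (a₃≺a₁ , a₃≺a₂) =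
  mirror d , ∈-++⁺ʳ D (∈-map⁺ mirror d∈) ,
  Before-mirror r d {a₃} {a₁} (swap a₁∥a₃) a₃≺a₁ , Before-mirror r d {a₃} {a₂} (swap a₂∥a₃) a₃≺a₂

mainTheorem4 : (Δ r : ℕ) → 1 ≤ Δ → 1 ≤ r →
    (a w : ℕ) → IsAlpha Δ r a → IsOmega Δ r w → a ≤ 2 * w
mainTheorem4 Δ r _ _ a w (_ , a-minimal) ((D , weak , ∣D∣≡w) , _) =
  subst (a ≤_) ∣D++mirrorD∣≡2w (a-minimal (D ++ map mirror D) (ThreeSuitable-++-mirror weak))
  where
  open ≡-Reasoning
  ∣D++mirrorD∣≡2w : length (D ++ map mirror D) ≡ 2 * w
  ∣D++mirrorD∣≡2w = begin
    length (D ++ map mirror D)          ≡⟨ length-++ D ⟩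
    length D + length (map mirror D)    ≡⟨ cong (length D +_) (length-map mirror D) ⟩
    length D + length D                 ≡⟨ cong (λ n → n + n) ∣D∣≡w ⟩
    w + w                               ≡⟨ cong (w +_) (sym (+-identityʳ w)) ⟩
    2 * w                               ∎
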